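{- Let $G=(V,E)$ be a finite simple undirected graph and let $D$ be a defensive alliance in $G$. Let $S$ be the set of crucial vertices in $D$. Consider the following procedure (Algorithm 1): for each vertex $u$ of $D$ in turn, if all neighbours of $u$ in the current set $D$ are overprotected (with respect to the current set $D$), replace $D$ by $D\setminus\{u\}$; finally return $D$. Then the locally minimal defensive alliance returned by this procedure, applied to $D$, contains $S$.
   Context: $N(v)$ denotes the open neighbourhood, $N[v]=N(v)\cup\{v\}$, and for $X\subseteq V$, $d_X(v)=|N(v)\cap X|$. A non-empty set $D\subseteq V$ is a defensive alliance if every $v\in D$ is protected, i.e. $d_D(v)+1\geq d_{V\setminus D}(v)$. A defensive alliance $D$ is locally minimal if for every $v\in D$, $D\setminus\{v\}$ is not a defensive alliance. A vertex $v\in D$ is marginally protected if it becomes unprotected when any of its neighbours in $D$ is moved from $D$ to $V\setminus D$; it is overprotected if it remains protected even when any of its neighbours is moved from $D$ to $V\setminus D$. A vertex $u\in D$ is crucial in $D$ if $u$ has a marginally protected neighbour $u_1\in D$ and $u_1$ has a marginally protected neighbour $u_2\in D$ ($u_2$ and $u$ need not be distinct). -}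

module Defs where

open import Data.Nat using (ℕ; suc; _≤_; _≤?_)
open import Data.Bool using (Bool; false; T; T?; if_then_else_)
open import Data.Fin using (Fin)
open import Data.Fin.Properties using (all?)
open import Data.Fin.Subset using (Subset; _∈_; _∩_; ∁; ∣_∣; _-_; Nonempty)
open import Data.Fin.Subset.Properties using (_∈?_)
open import Data.Vec using (tabulate)
open import Data.List using (List; foldl)
open import Data.Product using (_×_; ∃)
open import Relation.Nullary using (¬_; Dec; does)
open import Relation.Nullary.Decidable using (_×-dec_; _→-dec_)
open import Relation.Binary.PropositionalEquality using (_≡_)

record Graph (n : ℕ) : Set where
  field
    adj    : Fin n → Fin n → Bool
    sym    : ∀ u v → adj u v ≡ adj v u
    irrefl : ∀ v → adj v v ≡ false

module _ {n : ℕ} (G : Graph n) where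
  open Graph G

  Adj : Fin n → Fin n → Set
  Adj u v = T (adj u v)

  N : Fin n → Subset n
  N v = tabulate (adj v)

  deg : Subset n → Fin n → ℕ
  deg X v = ∣ N v ∩ X ∣

  Protected : Subset n → Fin n → Set
  Protected D v = deg (∁ D) v ≤ suc (deg D v)

  DefensiveAlliance : Subset n → Set
  DefensiveAlliance D = Nonempty D × (∀ v → v ∈ D → Protected D v)

  MarginallyProtected : Subset n → Fin n → Set
  MarginallyProtected D v =
    v ∈ D × (∀ w → Adj v w → w ∈ D → ¬ Protected (D - w) v)

  Overprotected : Subset n → Fin n → Set
  Overprotected D v =
    v ∈ D × (∀ w → Adj v w → w ∈ D → Protected (D - w) v)

  -- u ∈ D has a marginally protected neighbour u₁ ∈ D which has a
  -- marginally protected neighbour u₂ ∈ D (u₂ = u allowed)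
  Crucial : Subset n → Fin n → Set
  Crucial D u =
    u ∈ D × ∃ λ u₁ → Adj u u₁ × u₁ ∈ D × MarginallyProtected D u₁ ×
            ∃ λ u₂ → Adj u₁ u₂ × u₂ ∈ D × MarginallyProtected D u₂

  AllNbrsOverprotected : Subset n → Fin n → Set
  AllNbrsOverprotected D u = ∀ w → Adj u w → w ∈ D → Overprotected D w

  protected? : ∀ D v → Dec (Protected D v)
  protected? D v = deg (∁ D) v ≤? suc (deg D v)

  overprotected? : ∀ D v → Dec (Overprotected D v)
  overprotected? D v =
    (v ∈? D) ×-dec all? (λ w → T? (adj v w) →-dec ((w ∈? D) →-dec protected? (D - w) v))

  allNbrsOverprotected? : ∀ D u → Dec (AllNbrsOverprotected D u)
  allNbrsOverprotected? D u =
    all? (λ w → T? (adj u w) →-dec ((w ∈? D) →-dec overprotected? D w))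

  step : Subset n → Fin n → Subset n
  step D u = if does (allNbrsOverprotected? D u) then D - u else D

  algorithm1 : Subset n → List (Fin n) → Subset n
  algorithm1 D order = foldl step D order

{-# OPTIONS --safe #-}

-- Let u be crucial, with marginally protected neighbour u₁, which has the
-- marginally protected neighbour u₂.  Each of u, u₁, u₂ has a neighbour among
-- them that is marginally protected in D.  Protection is monotone in the set,
-- so a vertex marginally protected in D is not overprotected in any X ⊆ D that
-- still contains one of its neighbours.  Hence, as long as the three vertices
-- are present, none of them has all neighbours overprotected, and Algorithm 1
-- never removes any of them, whatever the order.

module Submission where

open import Defs
open import Data.Nat using (ℕ; _≤_; s≤s)
open import Data.Nat.Properties using (≤-trans)
open import Data.Fin using (Fin; _≟_)
open import Data.Fin.Subset using (Subset; _∈_; _∉_; _⊆_; _∩_; _─_; _-_; ⁅_⁆; inside)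
open import Data.Fin.Subset.Properties
  using (p⊆q⇒∣p∣≤∣q∣; p⊆q⇒∁p⊇∁q; x∈p∩q⁺; x∈p∩q⁻; x∈p∧x∉q⇒x∈p─q; p─q⊆p; x∈p∧x≢y⇒x∈p-y; ⊆-trans)
open import Data.Vec using (_∷_; here; there)
open import Data.List using (List; []; _∷_)
open import Data.List.Relation.Unary.Unique.Propositional using (Unique)
open import Data.List.Membership.Propositional using () renaming (_∈_ to _∈ₗ_)
open import Data.Bool using (T; if_then_else_)
open import Data.Product using (_×_; _,_; ∃)
open import Data.Sum using (_⊎_; inj₁; inj₂)
open import Function using (id)
open import Function.Bundles using (_⇔_)
open import Relation.Nullary using (¬_; Dec; does; yes; no; contradiction)
open import Relation.Binary.PropositionalEquality using (_≡_; refl; subst)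

x∈p─q⇒x∉q : ∀ {n} {x : Fin n} (p q : Subset n) → x ∈ p ─ q → x ∉ q
x∈p─q⇒x∉q (_ ∷ p) (_ ∷ q)      (there x∈p─q) (there x∈q) = x∈p─q⇒x∉q p q x∈p─q x∈q
x∈p─q⇒x∉q (_ ∷ p) (inside ∷ q) ()            here

p⊆q⇒p-x⊆q-x : ∀ {n} {p q : Subset n} (x : Fin n) → p ⊆ q → p - x ⊆ q - x
p⊆q⇒p-x⊆q-x {p = p} x p⊆q y∈p-x =
  x∈p∧x∉q⇒x∈p─q (p⊆q (p─q⊆p p ⁅ x ⁆ y∈p-x)) (x∈p─q⇒x∉q p ⁅ x ⁆ y∈p-x)

p⊆q⇒r∩p⊆r∩q : ∀ {n} (r : Subset n) {p q : Subset n} → p ⊆ q → r ∩ p ⊆ r ∩ q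
p⊆q⇒r∩p⊆r∩q r {p} p⊆q x∈r∩p with x∈p∩q⁻ r p x∈r∩p
... | x∈r , x∈p = x∈p∩q⁺ (x∈r , p⊆q x∈p)

if-does-cases : ∀ {a p} {A : Set a} {P : Set p} (d : Dec P) {x y : A} →
                (P × (if does d then x else y) ≡ x) ⊎ (if does d then x else y) ≡ y
if-does-cases (yes p) = inj₁ (p , refl)
if-does-cases (no _)  = inj₂ refl

module _ {n : ℕ} (G : Graph n) where

  Adj-sym : ∀ {u v} → Adj G u v → Adj G v u
  Adj-sym {u} {v} = subst T (Graph.sym G u v)

  deg-mono : ∀ {X Y} v → X ⊆ Y → deg G X v ≤ deg G Y v
  deg-mono v X⊆Y = p⊆q⇒∣p∣≤∣q∣ (p⊆q⇒r∩p⊆r∩q (N G v) X⊆Y)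

  Protected-mono : ∀ {X Y} v → X ⊆ Y → Protected G X v → Protected G Y v
  Protected-mono v X⊆Y prot =
    ≤-trans (deg-mono v (p⊆q⇒∁p⊇∁q X⊆Y)) (≤-trans prot (s≤s (deg-mono v X⊆Y)))

  marginal⇒¬overprotected : ∀ {D X a b} → X ⊆ D → MarginallyProtected G D a →
                            Adj G a b → b ∈ X → ¬ Overprotected G X a
  marginal⇒¬overprotected X⊆D (_ , marginal) ab b∈X (_ , over) =
    marginal _ ab (X⊆D b∈X) (Protected-mono _ (p⊆q⇒p-x⊆q-x _ X⊆D) (over _ ab b∈X))

  step-cases : ∀ X x → (AllNbrsOverprotected G X x × step G X x ≡ X - x) ⊎ step G X x ≡ X
  step-cases X x = if-does-cases (allNbrsOverprotected? G X x)

  step-⊆ : ∀ X x → step G X x ⊆ X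
  step-⊆ X x with step G X x | step-cases X x
  ... | _ | inj₁ (_ , refl) = p─q⊆p X ⁅ x ⁆
  ... | _ | inj₂ refl       = id

  step-keeps : ∀ {X y} x → y ∈ X → ¬ AllNbrsOverprotected G X y → y ∈ step G X x
  step-keeps {X} {y} x y∈X ¬all with step G X x | step-cases X x | y ≟ x
  ... | _ | inj₁ (all , _)  | yes refl = contradiction all ¬all
  ... | _ | inj₁ (_ , refl) | no y≢x   = x∈p∧x≢y⇒x∈p-y y∈X y≢x
  ... | _ | inj₂ refl       | _        = y∈X

  Anchored : Subset n → (Fin n → Set) → Set
  Anchored D P = ∀ {v} → P v → ∃ λ w → Adj G v w × P w × MarginallyProtected G D w

  algorithm1-keeps : ∀ {D} {P : Fin n → Set} → Anchored D P →
                     ∀ X → X ⊆ D → (∀ {v} → P v → v ∈ X) →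
                     ∀ order {v} → P v → v ∈ algorithm1 G X order
  algorithm1-keeps anchored X X⊆D P⊆X []          = P⊆X
  algorithm1-keeps {P = P} anchored X X⊆D P⊆X (x ∷ order) =
    algorithm1-keeps anchored (step G X x) (⊆-trans (step-⊆ X x) X⊆D) P⊆step order
    where
    P⊆step : ∀ {v} → P v → v ∈ step G X x
    P⊆step v∈P with anchored v∈P
    ... | w , vw , w∈P , w-marginal =
      step-keeps x (P⊆X v∈P) λ all →
        marginal⇒¬overprotected X⊆D w-marginal (Adj-sym vw) (P⊆X v∈P) (all w vw (P⊆X w∈P))

  crucial-triple-anchored : ∀ {D u u₁ u₂} → Adj G u u₁ → MarginallyProtected G D u₁ →
                            Adj G u₁ u₂ → MarginallyProtected G D u₂ →
                            Anchored D (λ v → v ≡ u ⊎ v ≡ u₁ ⊎ v ≡ u₂)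
  crucial-triple-anchored {u₁ = u₁} {u₂} uu₁ u₁-marginal u₁u₂ u₂-marginal = λ where
    (inj₁ refl)        → u₁ , uu₁ , inj₂ (inj₁ refl) , u₁-marginal
    (inj₂ (inj₁ refl)) → u₂ , u₁u₂ , inj₂ (inj₂ refl) , u₂-marginal
    (inj₂ (inj₂ refl)) → u₁ , Adj-sym u₁u₂ , inj₂ (inj₁ refl) , u₁-marginal

lemma1 : ∀ {n : ℕ} (G : Graph n) (D : Subset n) → DefensiveAlliance G D →
         (order : List (Fin n)) → Unique order → (∀ v → (v ∈ D) ⇔ (v ∈ₗ order)) →
         ∀ u → Crucial G D u → u ∈ algorithm1 G D order
lemma1 G D _ order _ _ u (u∈D , u₁ , uu₁ , u₁∈D , u₁-marginal , u₂ , u₁u₂ , u₂∈D , u₂-marginal) =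
  algorithm1-keeps G (crucial-triple-anchored G uu₁ u₁-marginal u₁u₂ u₂-marginal)
    D id triple⊆D order (inj₁ refl)
  where
  triple⊆D : ∀ {v} → v ≡ u ⊎ v ≡ u₁ ⊎ v ≡ u₂ → v ∈ D
  triple⊆D (inj₁ refl)        = u∈D
  triple⊆D (inj₂ (inj₁ refl)) = u₁∈D
  triple⊆D (inj₂ (inj₂ refl)) = u₂∈D
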